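{- Let $p$ be an odd prime and let $u,v$ be integers with $u^2\equiv -3\pmod p$ and $v\equiv -1\pmod p$. Then the sequences $(\alpha_i)_{i\ge1}$, $(\beta_i)_{i\ge 1}$ defined below satisfy, for all $k\ge 0$: $\alpha_{3k+1}\equiv -u$, $\alpha_{3k+2}+\alpha_{3k+3}\equiv u\pmod p$; $\alpha_{9k+2}\equiv 0$, $\alpha_{9k+5}\equiv\alpha_{3k+2}$, $\alpha_{9k+8}\equiv u\pmod p$; $\beta_1\equiv 1$, $\beta_2\equiv -2$, $\beta_{k+3}\equiv -1\pmod p$.
   Context: Given $u,v$, define rational numbers $\alpha_i,\beta_i$ ($i\ge 1$) by $\alpha_1=-u$, $\alpha_2=\frac{u(2v-1-u^2)}{v-u^2}$, $\alpha_3=\frac{ -u(v-1)}{v-u^2}$, $\beta_1=1$, $\beta_2=u^2-v$, $\beta_3=\frac{u^2+u^4+v^3-3u^2v}{(v-u^2)^2}$, and for every $k\ge 0$: $\alpha_{3k+4}=-u$, $\beta_{3k+4}=\frac{\beta_{k+2}}{\beta_{3k+3}\beta_{3k+2}}$, $\beta_{3k+5}=u^2-v-\beta_{3k+4}$, $\alpha_{3k+5}=u-\frac{\alpha_{k+2}+uv-\alpha_{3k+2}\beta_{3k+4}}{\beta_{3k+5}}$, $\alpha_{3k+6}=u-\alpha_{3k+5}$, $\beta_{3k+6}=v-\alpha_{3k+5}\alpha_{3k+6}$. Congruences modulo $p$ between rational numbers are understood in the local ring $\mathbb{Z}_{(p)}$ of rationals with denominator prime to $p$; asserting such a congruence for $\alpha_i$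 or $\beta_i$ includes that it is well defined (no division by zero) and lies in $\mathbb{Z}_{(p)}$. -}

module Defs where

open import Data.Nat as ℕ using (ℕ; zero; suc; _≟_)
open import Data.Nat.Divisibility using (_∣_)
open import Data.Integer as ℤ using (ℤ)
open import Data.Rational as ℚ using (ℚ; 0ℚ; 1ℚ; _÷_; ≢-nonZero)
open import Data.Rational.Properties using () renaming (_≟_ to _≟ℚ_)
open import Data.Maybe using (Maybe; just; nothing; _>>=_)
open import Data.Product using (Σ; _×_; _,_; proj₁; proj₂)
open import Relation.Nullary using (¬_; yes; no)
open import Relation.Binary.PropositionalEquality using (_≡_)

-- Partial arithmetic on rationals: `nothing` records an undefined value
-- (a division by zero somewhere along the computation).
M : Set
M = Maybe ℚ

lift₂ : (ℚ → ℚ → ℚ) → M → M → M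
lift₂ f a b = a >>= λ x → b >>= λ y → just (f x y)

_⊕_ _⊖_ _⊗_ : M → M → M
_⊕_ = lift₂ ℚ._+_
_⊖_ = lift₂ ℚ._-_
_⊗_ = lift₂ ℚ._*_

_⊘_ : M → M → M
a ⊘ b = a >>= λ x → b >>= λ y → div x y
  where
  div : ℚ → ℚ → M
  div x y with y ≟ℚ 0ℚ
  ... | yes _  = nothing
  ... | no y≢0 = just ((x ÷ y) {{≢-nonZero y≢0}})

infixl 6 _⊕_ _⊖_
infixl 7 _⊗_ _⊘_

int : ℤ → M
int z = just (ℚ._/_ z 1)

Entry : Set
Entry = M × M

-- Initial values α_1..α_3, β_1..β_3 (indices outside 1..3 are `nothing`).
module Seq (u v : ℤ) where
  U V : M
  U = int u
  V = int v
  one : M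
  one = int (ℤ.+ 1)

  initial : ℕ → Entry
  initial 1 = (int (ℤ.- u)) , one
  initial 2 = (U ⊗ (int (ℤ.+ 2) ⊗ V ⊖ one ⊖ U ⊗ U) ⊘ (V ⊖ U ⊗ U)) , (U ⊗ U ⊖ V)
  initial 3 = (int (ℤ.- u) ⊗ (V ⊖ one) ⊘ (V ⊖ U ⊗ U))
            , ((U ⊗ U ⊕ U ⊗ U ⊗ U ⊗ U ⊕ V ⊗ V ⊗ V ⊖ int (ℤ.+ 3) ⊗ U ⊗ U ⊗ V)
               ⊘ ((V ⊖ U ⊗ U) ⊗ (V ⊖ U ⊗ U)))
  initial _ = nothing , nothing

  newEntries : ℕ → (ℕ → Entry) → Entry × Entry × Entry
  newEntries k f = (a4 , b4) , (a5 , b5) , (a6 , b6)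
    where
    α β : ℕ → M
    α j = proj₁ (f j)
    β j = proj₂ (f j)
    a4 b4 a5 b5 a6 b6 : M
    a4 = int (ℤ.- u)
    b4 = β (k ℕ.+ 2) ⊘ (β (3 ℕ.* k ℕ.+ 3) ⊗ β (3 ℕ.* k ℕ.+ 2))
    b5 = U ⊗ U ⊖ V ⊖ b4
    a5 = U ⊖ (α (k ℕ.+ 2) ⊕ U ⊗ V ⊖ α (3 ℕ.* k ℕ.+ 2) ⊗ b4) ⊘ b5
    a6 = U ⊖ a5
    b6 = V ⊖ a5 ⊗ a6

  block : ℕ → (ℕ → Entry) → ℕ → Entry
  block k f i with i ≟ 3 ℕ.* k ℕ.+ 4 | i ≟ 3 ℕ.* k ℕ.+ 5 | i ≟ 3 ℕ.* k ℕ.+ 6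
  ... | yes _ | _     | _     = proj₁ (newEntries k f)
  ... | no _  | yes _ | _     = proj₁ (proj₂ (newEntries k f))
  ... | no _  | no _  | yes _ = proj₂ (proj₂ (newEntries k f))
  ... | no _  | no _  | no _  = f i

  -- table n is correct on indices 1 .. 3n+3
  table : ℕ → ℕ → Entry
  table zero    = initial
  table (suc k) = block k (table k)

  α β : ℕ → M
  α i = proj₁ (table i i)
  β i = proj₂ (table i i)

InZp : ℕ → ℚ → Set
InZp p q = ¬ (p ∣ ℚ.denominatorℕ q)

CongQ : ℕ → ℚ → ℚ → Set
CongQ p x y = InZp p x × InZp p y × (p ∣ ℤ.∣ ℚ.numerator (x ℚ.- y) ∣)

_≡_[mod_] : M → M → ℕ → Set
a ≡ b [mod p ] = Σ ℚ λ x → Σ ℚ λ y → (a ≡ just x) × (b ≡ just y) × CongQ p x y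

infix 4 _≡_[mod_]

{-# OPTIONS --safe #-}
module Submission where

-- Modulo p we have u² ≡ -3 and v ≡ -1, so v - u² ≡ 2 is a unit and every αᵢ, βᵢ turns out to
-- be defined, to lie in ℤ_(p) and to be congruent to an explicit integer.  Induction over the
-- blocks of indices 3k+1, 3k+2, 3k+3 gives β_{3k+4} ≡ β_{3k+5} ≡ -1 and
-- α_{3k+5} ≡ α_{k+2} + α_{3k+2}, hence α_{3k+2} ≡ c_k (α₂-residue k below), where c_k = u
-- if the last ternary digit of k different from 1 is 2, and c_k = 0 otherwise: indeed
-- c_{3j} = 0, c_{3j+1} = c_j, c_{3j+2} = u, and c_{k+1} = α_{k+2} + c_k is checked according to
-- k mod 3.  Since c_k (u - c_k) = 0, also β_{3k+6} = v - α_{3k+5} α_{3k+6} ≡ -1.  The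
-- congruences for α_{9k+2}, α_{9k+5} and α_{9k+8} are then c_{3k} = 0, c_{3k+1} = c_k and
-- c_{3k+2} = u.

open import Data.Nat using (ℕ)
open import Data.Nat.Primality using (Prime)
open import Data.Integer using (ℤ)
open import Relation.Binary.PropositionalEquality using (_≡_; _≢_)
open import Data.Integer.Divisibility.Signed using (_∣_)
import Data.Integer as ℤ

open import Defs

module Residues (p : ℕ) (p-prime : Prime p) where

  import Data.Nat.Divisibility as ℕ
  open import Data.Nat.Primality using (euclidsLemma; ¬prime[1])
  open import Data.Nat.Coprimality using (recompute)
  open import Data.Integer as ℤ using (+_; _*_; _+_; _-_; -_; -[1+_]; +[1+_])
  import Data.Integer.Properties as ℤ
  open import Data.Integer.Divisibility.Signed
  open import Data.Integer.Tactic.RingSolver using (solve-∀)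
  open import Data.Rational as ℚ using (ℚ; mkℚ; 0ℚ; _÷_; toℚᵘ)
  import Data.Rational.Properties as ℚ
  open import Data.Rational.Unnormalised as ℚᵘ using (ℚᵘ; mkℚᵘ; _≃_; ↥_; ↧_)
  import Data.Rational.Unnormalised.Properties as ℚᵘ
  open import Data.Maybe using (just)
  open import Data.Product using (Σ-syntax; _×_; _,_)
  open import Data.Sum using (_⊎_; inj₁; inj₂)
  open import Relation.Nullary using (¬_; yes; no; contradiction)
  open import Relation.Binary.PropositionalEquality
  open import Algebra.Properties.CommutativeSemigroup ℤ.*-commutativeSemigroup
    using (xy∙z≈xz∙y; interchange)

  euclidsLemmaℤ : ∀ m n → + p ∣ m * n → + p ∣ m ⊎ + p ∣ n
  euclidsLemmaℤ m n p∣mn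
    with euclidsLemma ℤ.∣ m ∣ ℤ.∣ n ∣ p-prime (subst (p ℕ.∣_) (ℤ.abs-* m n) (∣⇒∣ᵤ p∣mn))
  ... | inj₁ p∣m = inj₁ (∣ᵤ⇒∣ p∣m)
  ... | inj₂ p∣n = inj₂ (∣ᵤ⇒∣ p∣n)

  ∤-* : ∀ {m n} → ¬ + p ∣ m → ¬ + p ∣ n → ¬ + p ∣ m * n
  ∤-* {m} {n} p∤m p∤n p∣mn with euclidsLemmaℤ m n p∣mn
  ... | inj₁ p∣m = p∤m p∣m
  ... | inj₂ p∣n = p∤n p∣n

  ∤-cancelʳ : ∀ {m n} → ¬ + p ∣ n → + p ∣ m * n → + p ∣ m
  ∤-cancelʳ {m} {n} p∤n p∣mn with euclidsLemmaℤ m n p∣mn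
  ... | inj₁ p∣m = p∣m
  ... | inj₂ p∣n = contradiction p∣n p∤n

  ≡0⇒∣ : ∀ {m} → m ≡ + 0 → + p ∣ m
  ≡0⇒∣ refl = divides (+ 0) refl

  ∤1 : ¬ + p ∣ + 1
  ∤1 p∣1 = ¬prime[1] (subst Prime (ℕ.∣1⇒≡1 (∣⇒∣ᵤ p∣1)) p-prime)

  ∤-neg : ∀ {m} → ¬ + p ∣ m → ¬ + p ∣ - m
  ∤-neg {m} p∤m p∣-m = p∤m (subst (+ p ∣_) (ℤ.neg-involutive m) (∣m⇒∣-m p∣-m))

  record Fraction (x : ℚᵘ) : Set where
    constructor fraction
    field
      num den   : ℤ
      den-unit  : ¬ + p ∣ den
      x≃num/den : ↥ x * den ≡ num * ↧ x

  -- x ∈ ℤ_(p) and x ≡ r (mod p), witnessed by a representation of x as a fraction with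
  -- denominator prime to p (not necessarily in lowest terms).
  record Residue (x : ℚᵘ) (r : ℤ) : Set where
    constructor residue
    field
      frac : Fraction x
    open Fraction frac public
    field
      num≡r*den : + p ∣ num - r * den

  open Fraction using (num)

  fraction-resp-≃ : ∀ {x y} → x ≃ y → Fraction x → Fraction y
  fraction-resp-≃ {x} {y} x≃y (fraction n d d-unit x≃n/d) =
    fraction n d d-unit (ℤ.*-cancelʳ-≡ _ _ (↧ x) (begin
      ↥ y * d * ↧ x ≡⟨ xy∙z≈xz∙y (↥ y) d (↧ x) ⟩
      ↥ y * ↧ x * d ≡⟨ cong (_* d) (ℚᵘ.drop-*≡* x≃y) ⟨
      ↥ x * ↧ y * d ≡⟨ xy∙z≈xz∙y (↥ x) (↧ y) d ⟩
      ↥ x * d * ↧ y ≡⟨ cong (_* ↧ y) x≃n/d ⟩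
      n * ↧ x * ↧ y ≡⟨ xy∙z≈xz∙y n (↧ x) (↧ y) ⟩
      n * ↧ y * ↧ x ∎))
    where open ≡-Reasoning

  fraction-+ : ∀ {x y} → Fraction x → Fraction y → Fraction (x ℚᵘ.+ y)
  fraction-+ {x} {y} (fraction n₁ d₁ u₁ e₁) (fraction n₂ d₂ u₂ e₂) =
    fraction (n₁ * d₂ + n₂ * d₁) (d₁ * d₂) (∤-* u₁ u₂) (sum x y e₁ e₂)
    where
    open ≡-Reasoning
    expand : ∀ a b c e f g → (a * b + c * e) * (f * g) ≡ (a * f) * (g * b) + (c * g) * (f * e)
    expand = solve-∀
    collect : ∀ a b c e f g → (a * b) * (c * e) + (f * e) * (g * b) ≡ (a * c + f * g) * (b * e)
    collect = solve-∀
    sum : ∀ x y → ↥ x * d₁ ≡ n₁ * ↧ x → ↥ y * d₂ ≡ n₂ * ↧ y →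
          ↥ (x ℚᵘ.+ y) * (d₁ * d₂) ≡ (n₁ * d₂ + n₂ * d₁) * ↧ (x ℚᵘ.+ y)
    sum x@record{} y@record{} e₁ e₂ = begin
      (↥ x * ↧ y + ↥ y * ↧ x) * (d₁ * d₂)               ≡⟨ expand (↥ x) (↧ y) (↥ y) (↧ x) d₁ d₂ ⟩
      (↥ x * d₁) * (d₂ * ↧ y) + (↥ y * d₂) * (d₁ * ↧ x) ≡⟨ cong₂ (λ s t → s * (d₂ * ↧ y) + t * (d₁ * ↧ x)) e₁ e₂ ⟩
      (n₁ * ↧ x) * (d₂ * ↧ y) + (n₂ * ↧ y) * (d₁ * ↧ x) ≡⟨ collect n₁ (↧ x) d₂ (↧ y) n₂ d₁ ⟩
      (n₁ * d₂ + n₂ * d₁) * (↧ x * ↧ y)                 ∎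

  fraction-* : ∀ {x y} → Fraction x → Fraction y → Fraction (x ℚᵘ.* y)
  fraction-* {x} {y} (fraction n₁ d₁ u₁ e₁) (fraction n₂ d₂ u₂ e₂) =
    fraction (n₁ * n₂) (d₁ * d₂) (∤-* u₁ u₂) (product x y e₁ e₂)
    where
    open ≡-Reasoning
    product : ∀ x y → ↥ x * d₁ ≡ n₁ * ↧ x → ↥ y * d₂ ≡ n₂ * ↧ y →
              ↥ (x ℚᵘ.* y) * (d₁ * d₂) ≡ (n₁ * n₂) * ↧ (x ℚᵘ.* y)
    product x@record{} y@record{} e₁ e₂ = begin
      (↥ x * ↥ y) * (d₁ * d₂) ≡⟨ interchange (↥ x) (↥ y) d₁ d₂ ⟩
      (↥ x * d₁) * (↥ y * d₂) ≡⟨ cong₂ _*_ e₁ e₂ ⟩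
      (n₁ * ↧ x) * (n₂ * ↧ y) ≡⟨ interchange n₁ (↧ x) n₂ (↧ y) ⟩
      (n₁ * n₂) * (↧ x * ↧ y) ∎

  fraction-neg : ∀ {x} → Fraction x → Fraction (ℚᵘ.- x)
  fraction-neg {x} (fraction n d u e) = fraction (- n) d u (negation x e)
    where
    open ≡-Reasoning
    negation : ∀ x → ↥ x * d ≡ n * ↧ x → ↥ (ℚᵘ.- x) * d ≡ - n * ↧ (ℚᵘ.- x)
    negation x@record{} e = begin
      - ↥ x * d   ≡⟨ ℤ.neg-distribˡ-* (↥ x) d ⟨
      - (↥ x * d) ≡⟨ cong -_ e ⟩
      - (n * ↧ x) ≡⟨ ℤ.neg-distribˡ-* n (↧ x) ⟩
      - n * ↧ x   ∎

  fraction-1/ : ∀ {x} .{{_ : ℚᵘ.NonZero x}} (f : Fraction x) → ¬ + p ∣ num f → Fraction (ℚᵘ.1/ x)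
  fraction-1/ {x} (fraction n d _ e) n-unit = fraction d n n-unit (reciprocal x e)
    where
    open ≡-Reasoning
    reciprocal : ∀ x .{{_ : ℚᵘ.NonZero x}} → ↥ x * d ≡ n * ↧ x → ↥ (ℚᵘ.1/ x) * n ≡ d * ↧ (ℚᵘ.1/ x)
    reciprocal (mkℚᵘ +[1+ a ] b) e = begin
      +[1+ b ] * n ≡⟨ ℤ.*-comm +[1+ b ] n ⟩
      n * +[1+ b ] ≡⟨ e ⟨
      +[1+ a ] * d ≡⟨ ℤ.*-comm +[1+ a ] d ⟩
      d * +[1+ a ] ∎
    reciprocal (mkℚᵘ -[1+ a ] b) e = begin
      -[1+ b ] * n       ≡⟨ ℤ.neg-distribˡ-* +[1+ b ] n ⟨
      - (+[1+ b ] * n)   ≡⟨ cong -_ (ℤ.*-comm +[1+ b ] n) ⟩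
      - (n * +[1+ b ])   ≡⟨ cong -_ e ⟨
      - (-[1+ a ] * d)   ≡⟨ cong -_ (ℤ.neg-distribˡ-* +[1+ a ] d) ⟨
      - - (+[1+ a ] * d) ≡⟨ ℤ.neg-involutive _ ⟩
      +[1+ a ] * d       ≡⟨ ℤ.*-comm +[1+ a ] d ⟩
      d * +[1+ a ]       ∎

  residue-resp-≃ : ∀ {x y r} → x ≃ y → Residue x r → Residue y r
  residue-resp-≃ x≃y (residue f n≡rd) = residue (fraction-resp-≃ x≃y f) n≡rd

  residue-mod : ∀ {x r s} → Residue x r → + p ∣ r - s → Residue x s
  residue-mod {r = r} {s} (residue f@(fraction n d _ _) n≡rd) r≡s = residue f
    (subst (+ p ∣_) (sym (split n d r s)) (∣m∣n⇒∣m+n n≡rd (∣m⇒∣m*n d r≡s)))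
    where
    split : ∀ n d r s → n - s * d ≡ (n - r * d) + (r - s) * d
    split = solve-∀

  residue-+ : ∀ {x y r s} → Residue x r → Residue y s → Residue (x ℚᵘ.+ y) (r + s)
  residue-+ {r = r} {s} (residue f₁@(fraction n₁ d₁ _ _) h₁) (residue f₂@(fraction n₂ d₂ _ _) h₂) =
    residue (fraction-+ f₁ f₂)
      (subst (+ p ∣_) (sym (split n₁ d₁ n₂ d₂ r s)) (∣m∣n⇒∣m+n (∣m⇒∣m*n d₂ h₁) (∣m⇒∣m*n d₁ h₂)))
    where
    split : ∀ n₁ d₁ n₂ d₂ r s →
            (n₁ * d₂ + n₂ * d₁) - (r + s) * (d₁ * d₂) ≡ (n₁ - r * d₁) * d₂ + (n₂ - s * d₂) * d₁
    split = solve-∀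

  residue-* : ∀ {x y r s} → Residue x r → Residue y s → Residue (x ℚᵘ.* y) (r * s)
  residue-* {r = r} {s} (residue f₁@(fraction n₁ d₁ _ _) h₁) (residue f₂@(fraction n₂ d₂ _ _) h₂) =
    residue (fraction-* f₁ f₂)
      (subst (+ p ∣_) (sym (split n₁ d₁ n₂ d₂ r s)) (∣m∣n⇒∣m+n (∣m⇒∣m*n n₂ h₁) (∣n⇒∣m*n (r * d₁) h₂)))
    where
    split : ∀ n₁ d₁ n₂ d₂ r s →
            n₁ * n₂ - r * s * (d₁ * d₂) ≡ (n₁ - r * d₁) * n₂ + r * d₁ * (n₂ - s * d₂)
    split = solve-∀

  residue-neg : ∀ {x r} → Residue x r → Residue (ℚᵘ.- x) (- r)
  residue-neg {r = r} (residue f@(fraction n d _ _) h) =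
    residue (fraction-neg f) (subst (+ p ∣_) (sym (split n d r)) (∣m⇒∣-m h))
    where
    split : ∀ n d r → - n - - r * d ≡ - (n - r * d)
    split = solve-∀

  residue-num-unit : ∀ {x r} (res : Residue x r) → ¬ + p ∣ r → ¬ + p ∣ Residue.num res
  residue-num-unit {r = r} (residue (fraction n d d-unit _) h) r-unit p∣n =
    ∤-* r-unit d-unit (subst (+ p ∣_) (split n d r) (∣m∣n⇒∣m-n p∣n h))
    where
    split : ∀ n d r → n - (n - r * d) ≡ r * d
    split = solve-∀

  residue-÷ : ∀ {x y r s} t .{{_ : ℚᵘ.NonZero y}} → Residue x r → (res : Residue y s) → ¬ + p ∣ s →
              + p ∣ r - t * s → Residue (x ℚᵘ.* ℚᵘ.1/ y) t
  residue-÷ {r = r} {s} t (residue f₁@(fraction n₁ d₁ _ _) h₁) res@(residue f₂@(fraction n₂ d₂ _ _) h₂) s-unit r≡ts =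
    residue (fraction-* f₁ (fraction-1/ f₂ (residue-num-unit res s-unit)))
      (subst (+ p ∣_) (sym (split n₁ d₁ n₂ d₂ r s t))
        (∣m∣n⇒∣m-n (∣m∣n⇒∣m+n (∣m⇒∣m*n d₂ h₁) (∣m⇒∣m*n (d₁ * d₂) r≡ts)) (∣m⇒∣m*n (t * d₁) h₂)))
    where
    split : ∀ n₁ d₁ n₂ d₂ r s t → n₁ * d₂ - t * (d₁ * n₂)
            ≡ (n₁ - r * d₁) * d₂ + (r - t * s) * (d₁ * d₂) - (n₂ - s * d₂) * (t * d₁)
    split = solve-∀

  residue-int : ∀ z → Residue (mkℚᵘ z 0) z
  residue-int z = residue (fraction z (+ 1) ∤1 refl) (≡0⇒∣ (cancel z))
    where
    cancel : ∀ z → z - z * + 1 ≡ + 0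
    cancel = solve-∀

  residue-numerator : ∀ {x r} → Residue x r → + p ∣ r → + p ∣ ↥ x
  residue-numerator {x} {r} (residue (fraction n d d-unit e) n≡rd) p∣r =
    ∤-cancelʳ d-unit (subst (+ p ∣_) (sym e) (∣m⇒∣m*n (↧ x) p∣n))
    where
    split : ∀ n d r → n ≡ (n - r * d) + r * d
    split = solve-∀
    p∣n : + p ∣ n
    p∣n = subst (+ p ∣_) (sym (split n d r)) (∣m∣n⇒∣m+n n≡rd (∣m⇒∣m*n d p∣r))

  residue-↥≢0 : ∀ {x r} → Residue x r → ¬ + p ∣ r → ↥ x ≢ + 0
  residue-↥≢0 {x} res@(residue (fraction n d _ e) _) r-unit ↥x≡0 =
    residue-num-unit res r-unit (≡0⇒∣ n≡0)
    where
    n≡0 : n ≡ + 0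
    n≡0 = ℤ.*-cancelʳ-≡ n (+ 0) (↧ x) (trans (sym e) (cong (_* d) ↥x≡0))

  residue⇒InZp : ∀ {x r} → Residue (toℚᵘ x) r → InZp p x
  residue⇒InZp {mkℚ N D coprime} (residue (fraction n d d-unit e) _) p∣↧x =
    ¬prime[1] (subst Prime (recompute coprime (∣⇒∣ᵤ p∣N , p∣↧x)) p-prime)
    where
    p∣N : + p ∣ N
    p∣N = ∤-cancelʳ d-unit (subst (+ p ∣_) (sym e) (∣n⇒∣m*n n (∣ᵤ⇒∣ p∣↧x)))

  HasResidue : M → ℤ → Set
  HasResidue a r = Σ[ x ∈ ℚ ] a ≡ just x × Residue (toℚᵘ x) r

  int-residue : ∀ z → HasResidue (int z) z
  int-residue z = z ℚ./ 1 , refl , residue-resp-≃ (ℚᵘ.≃-sym (ℚ.toℚᵘ-fromℚᵘ (mkℚᵘ z 0))) (residue-int z)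

  HasResidue-mod : ∀ {a r s} → HasResidue a r → + p ∣ r - s → HasResidue a s
  HasResidue-mod (x , a≡x , res) r≡s = x , a≡x , residue-mod res r≡s

  infixl 6 _⊕ʳ_ _⊖ʳ_
  infixl 7 _⊗ʳ_

  _⊕ʳ_ : ∀ {a b r s} → HasResidue a r → HasResidue b s → HasResidue (a ⊕ b) (r + s)
  (x , refl , hx) ⊕ʳ (y , refl , hy) =
    x ℚ.+ y , refl , residue-resp-≃ (ℚᵘ.≃-sym (ℚ.toℚᵘ-homo-+ x y)) (residue-+ hx hy)

  _⊗ʳ_ : ∀ {a b r s} → HasResidue a r → HasResidue b s → HasResidue (a ⊗ b) (r * s)
  (x , refl , hx) ⊗ʳ (y , refl , hy) =
    x ℚ.* y , refl , residue-resp-≃ (ℚᵘ.≃-sym (ℚ.toℚᵘ-homo-* x y)) (residue-* hx hy)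

  residue-difference : ∀ {x y r s} → Residue (toℚᵘ x) r → Residue (toℚᵘ y) s → Residue (toℚᵘ (x ℚ.- y)) (r - s)
  residue-difference {x} {y} hx hy =
    residue-resp-≃ (ℚᵘ.≃-sym (ℚ.toℚᵘ-homo-+ x (ℚ.- y)))
      (residue-+ hx (residue-resp-≃ (ℚᵘ.≃-sym (ℚ.toℚᵘ-homo‿- y)) (residue-neg hy)))

  _⊖ʳ_ : ∀ {a b r s} → HasResidue a r → HasResidue b s → HasResidue (a ⊖ b) (r - s)
  (x , refl , hx) ⊖ʳ (y , refl , hy) = x ℚ.- y , refl , residue-difference hx hy

  ⊘-just : ∀ x y (y≢0 : y ≢ 0ℚ) → just x ⊘ just y ≡ just ((x ÷ y) {{ℚ.≢-nonZero y≢0}})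
  ⊘-just x y y≢0 with y ℚ.≟ 0ℚ
  ... | yes y≡0 = contradiction y≡0 y≢0
  ... | no _    = refl

  ⊘-residue : ∀ {a b r s} t → HasResidue a r → HasResidue b s → ¬ + p ∣ s → + p ∣ r - t * s →
              HasResidue (a ⊘ b) t
  ⊘-residue t (x , refl , hx) (y , refl , hy) s-unit r≡ts =
    (x ÷ y) {{y≢0}} , ⊘-just x y y≢0′ ,
    residue-resp-≃ (ℚᵘ.≃-sym (ℚᵘ.≃-trans (ℚ.toℚᵘ-homo-* x (ℚ.1/ y)) (ℚᵘ.*-congˡ {toℚᵘ x} (ℚ.toℚᵘ-homo-1/ y))))
      (residue-÷ t hx hy s-unit r≡ts)
    where
    y≢0′ : y ≢ 0ℚ
    y≢0′ y≡0 = residue-↥≢0 hy s-unit (trans (ℚ.↥ᵘ-toℚᵘ y) (cong ℚ.↥_ y≡0))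
    instance
      y≢0 : ℚ.NonZero y
      y≢0 = ℚ.≢-nonZero y≢0′

  residues⇒≡[mod] : ∀ {a b r s} → HasResidue a r → HasResidue b s → r ≡ s → a ≡ b [mod p ]
  residues⇒≡[mod] {r = r} (x , refl , hx) (y , refl , hy) refl =
    x , y , refl , refl , residue⇒InZp hx , residue⇒InZp hy ,
    ∣⇒∣ᵤ (subst (+ p ∣_) (ℚ.↥ᵘ-toℚᵘ (x ℚ.- y)) (residue-numerator (residue-difference hx hy) (≡0⇒∣ (ℤ.+-inverseʳ r))))

module Ternary where

  open import Data.Nat using (zero; suc; _+_; _*_; _<_; z≤n; s≤s)
  import Data.Nat.Properties as ℕ
  open import Data.Nat.Tactic.RingSolver using (solve-∀)
  open import Relation.Binary.PropositionalEquality

  quot₃ rem₃ : ℕ → ℕ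
  quot₃ (suc (suc (suc n))) = suc (quot₃ n)
  quot₃ _                   = 0
  rem₃ (suc (suc (suc n))) = rem₃ n
  rem₃ n                   = n

  private
    3[1+j]+r : ∀ j r → 3 * suc j + r ≡ 3 + (3 * j + r)
    3[1+j]+r = solve-∀

  3[1+j]≡1+[3j+2] : ∀ j → 3 * suc j ≡ suc (3 * j + 2)
  3[1+j]≡1+[3j+2] = solve-∀

  quot₃-3j+r : ∀ j r → r < 3 → quot₃ (3 * j + r) ≡ j
  quot₃-3j+r zero    0 _ = refl
  quot₃-3j+r zero    1 _ = refl
  quot₃-3j+r zero    2 _ = refl
  quot₃-3j+r zero    (suc (suc (suc _))) (s≤s (s≤s (s≤s ())))
  quot₃-3j+r (suc j) r r<3 rewrite 3[1+j]+r j r = cong suc (quot₃-3j+r j r r<3)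

  rem₃-3j+r : ∀ j r → r < 3 → rem₃ (3 * j + r) ≡ r
  rem₃-3j+r zero    0 _ = refl
  rem₃-3j+r zero    1 _ = refl
  rem₃-3j+r zero    2 _ = refl
  rem₃-3j+r zero    (suc (suc (suc _))) (s≤s (s≤s (s≤s ())))
  rem₃-3j+r (suc j) r r<3 rewrite 3[1+j]+r j r = rem₃-3j+r j r r<3

  quot₃<n : ∀ n → rem₃ n ≡ 1 → quot₃ n < n
  quot₃<n 1                   _ = s≤s z≤n
  quot₃<n (suc (suc (suc n))) r≡1 = s≤s (ℕ.m<n⇒m<1+n (ℕ.m<n⇒m<1+n (quot₃<n n r≡1)))

  -- The last digit ≠ 1 of the ternary expansion of n (or 0 if every digit is 1), computed with
  -- enough fuel to strip the trailing ones.
  lastNonOneDigitᶠ : ℕ → ℕ → ℕ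
  lastNonOneDigitᶠ zero       _ = 0
  lastNonOneDigitᶠ (suc fuel) n with rem₃ n
  ... | 1 = lastNonOneDigitᶠ fuel (quot₃ n)
  ... | r = r

  lastNonOneDigit : ℕ → ℕ
  lastNonOneDigit n = lastNonOneDigitᶠ (suc n) n

  lastNonOneDigitᶠ-fuel : ∀ {f g} n → n < f → n < g → lastNonOneDigitᶠ f n ≡ lastNonOneDigitᶠ g n
  lastNonOneDigitᶠ-fuel {suc f} {suc g} n (s≤s n≤f) (s≤s n≤g) with rem₃ n in r≡
  ... | 0           = refl
  ... | 1           = lastNonOneDigitᶠ-fuel (quot₃ n) (ℕ.<-≤-trans (quot₃<n n r≡) n≤f)
                                                  (ℕ.<-≤-trans (quot₃<n n r≡) n≤g)
  ... | suc (suc _) = refl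

  lastNonOneDigit-3j : ∀ j → lastNonOneDigit (3 * j) ≡ 0
  lastNonOneDigit-3j j rewrite sym (ℕ.+-identityʳ (3 * j)) | rem₃-3j+r j 0 (s≤s z≤n) = refl

  lastNonOneDigit-3j+1 : ∀ j → lastNonOneDigit (3 * j + 1) ≡ lastNonOneDigit j
  lastNonOneDigit-3j+1 j rewrite rem₃-3j+r j 1 (s≤s (s≤s z≤n)) | quot₃-3j+r j 1 (s≤s (s≤s z≤n)) =
    lastNonOneDigitᶠ-fuel j (ℕ.≤-<-trans (ℕ.m≤n*m j 3) (ℕ.m<m+n (3 * j) (s≤s z≤n))) ℕ.≤-refl

  lastNonOneDigit-3j+2 : ∀ j → lastNonOneDigit (3 * j + 2) ≡ 2
  lastNonOneDigit-3j+2 j rewrite rem₃-3j+r j 2 (s≤s (s≤s (s≤s z≤n))) = refl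

  data Ternary : ℕ → Set where
    [3*_]   : ∀ j → Ternary (3 * j)
    [3*_+1] : ∀ j → Ternary (3 * j + 1)
    [3*_+2] : ∀ j → Ternary (3 * j + 2)

  ternary : ∀ n → Ternary n
  ternary zero = [3* 0 ]
  ternary (suc n) with ternary n
  ... | [3* j ]   = subst Ternary (ℕ.+-comm (3 * j) 1) [3* j +1]
  ... | [3* j +1] = subst Ternary (ℕ.+-suc (3 * j) 1) [3* j +2]
  ... | [3* j +2] = subst Ternary (3[1+j]≡1+[3j+2] j) [3* suc j ]

module Unfolding (u v : ℤ) where

  open import Data.Nat using (zero; suc; _+_; _*_; _≤_; _≤′_; ≤′-refl; ≤′-step; _≟_; z≤n; s≤s)
  import Data.Nat.Properties as ℕ
  open import Data.Nat.Tactic.RingSolver using (solve-∀)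
  open import Data.Product using (_,_)
  open import Data.Sum using (inj₁; inj₂)
  open import Relation.Nullary using (¬_; yes; no; contradiction)
  open import Relation.Binary.PropositionalEquality

  open Seq u v

  entry : ℕ → Entry
  entry i = α i , β i

  private
    3k+4+c≰3k+3 : ∀ k c → ¬ 3 * k + (4 + c) ≤ 3 * k + 3
    3k+4+c≰3k+3 k c le with ℕ.+-cancelˡ-≤ (3 * k) _ _ le
    ... | s≤s (s≤s (s≤s ()))

    3k+c≢3k+c′ : ∀ k {c c′} → c ≢ c′ → 3 * k + c ≢ 3 * k + c′
    3k+c≢3k+c′ k c≢c′ eq = c≢c′ (ℕ.+-cancelˡ-≡ (3 * k) _ _ eq)

  block-below : ∀ k f i → i ≤ 3 * k + 3 → block k f i ≡ f i
  block-below k f i i≤ with i ≟ 3 * k + 4 | i ≟ 3 * k + 5 | i ≟ 3 * k + 6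
  ... | yes refl | _        | _        = contradiction i≤ (3k+4+c≰3k+3 k 0)
  ... | no _     | yes refl | _        = contradiction i≤ (3k+4+c≰3k+3 k 1)
  ... | no _     | no _     | yes refl = contradiction i≤ (3k+4+c≰3k+3 k 2)
  ... | no _     | no _     | no _     = refl

  block-new : ∀ k f → (block k f (3 * k + 4) , block k f (3 * k + 5) , block k f (3 * k + 6)) ≡ newEntries k f
  block-new k f = cong₂ _,_ block-4 (cong₂ _,_ block-5 block-6)
    where
    block-4 : block k f (3 * k + 4) ≡ _
    block-4 with 3 * k + 4 ≟ 3 * k + 4
    ... | yes _ = refl
    ... | no ≢ = contradiction refl ≢
    block-5 : block k f (3 * k + 5) ≡ _
    block-5 with 3 * k + 5 ≟ 3 * k + 4 | 3 * k + 5 ≟ 3 * k + 5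
    ... | yes eq | _     = contradiction eq (3k+c≢3k+c′ k λ ())
    ... | no _   | yes _ = refl
    ... | no _   | no ≢  = contradiction refl ≢
    block-6 : block k f (3 * k + 6) ≡ _
    block-6 with 3 * k + 6 ≟ 3 * k + 4 | 3 * k + 6 ≟ 3 * k + 5 | 3 * k + 6 ≟ 3 * k + 6
    ... | yes eq | _      | _     = contradiction eq (3k+c≢3k+c′ k λ ())
    ... | no _   | yes eq | _     = contradiction eq (3k+c≢3k+c′ k λ ())
    ... | no _   | no _   | yes _ = refl
    ... | no _   | no _   | no ≢  = contradiction refl ≢

  table-stable : ∀ {m n} i → m ≤′ n → i ≤ 3 * m + 3 → table n i ≡ table m i
  table-stable i ≤′-refl _ = refl
  table-stable i (≤′-step {n} m≤n) i≤ =
    trans (block-below n (table n) i (ℕ.≤-trans i≤ (ℕ.+-monoˡ-≤ 3 (ℕ.*-monoʳ-≤ 3 (ℕ.≤′⇒≤ m≤n)))))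
          (table-stable i m≤n i≤)

  table≡entry : ∀ k i → i ≤ 3 * k + 3 → table k i ≡ entry i
  table≡entry k i i≤ with ℕ.≤-total k i
  ... | inj₁ k≤i = sym (table-stable i (ℕ.≤⇒≤′ k≤i) i≤)
  ... | inj₂ i≤k = table-stable i (ℕ.≤⇒≤′ i≤k) (ℕ.≤-trans (ℕ.m≤n*m i 3) (ℕ.m≤m+n (3 * i) 3))

  newEntries-local : ∀ k (f g : ℕ → Entry) → f (k + 2) ≡ g (k + 2) → f (3 * k + 2) ≡ g (3 * k + 2)
                   → f (3 * k + 3) ≡ g (3 * k + 3) → newEntries k f ≡ newEntries k g
  newEntries-local k f g e₁ e₂ e₃ rewrite e₁ | e₂ | e₃ = refl

  entries-next : ∀ k → (entry (3 * suc k + 1) , entry (3 * suc k + 2) , entry (3 * suc k + 3)) ≡ newEntries k entry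
  entries-next k = begin
    (entry (3 * suc k + 1) , entry (3 * suc k + 2) , entry (3 * suc k + 3))
      ≡⟨ cong₂ _,_ (next 1 (s≤s z≤n)) (cong₂ _,_ (next 2 (s≤s (s≤s z≤n))) (next 3 ℕ.≤-refl)) ⟩
    (block k (table k) (3 * k + 4) , block k (table k) (3 * k + 5) , block k (table k) (3 * k + 6))
      ≡⟨ block-new k (table k) ⟩
    newEntries k (table k)
      ≡⟨ newEntries-local k (table k) entry (table≡entry k (k + 2) k+2≤) (table≡entry k (3 * k + 2) (ℕ.+-monoʳ-≤ (3 * k) (ℕ.n≤1+n 2)))
                            (table≡entry k (3 * k + 3) ℕ.≤-refl) ⟩
    newEntries k entry ∎
    where
    open ≡-Reasoning
    index : ∀ k c → 3 * suc k + c ≡ 3 * k + (3 + c)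
    index = solve-∀
    next : ∀ c → c ≤ 3 → entry (3 * suc k + c) ≡ block k (table k) (3 * k + (3 + c))
    next c c≤3 = trans (sym (table≡entry (suc k) _ (ℕ.+-monoʳ-≤ (3 * suc k) c≤3))) (cong (block k (table k)) (index k c))
    k+2≤ : k + 2 ≤ 3 * k + 3
    k+2≤ = ℕ.+-mono-≤ (ℕ.m≤n*m k 3) (ℕ.n≤1+n 2)


module Blocks (p : ℕ) (p-prime : Prime p) (p≢2 : p ≢ 2) (u v : ℤ)
              (u²≡-3 : ℤ.+ p ∣ u ℤ.* u ℤ.+ ℤ.+ 3) (v≡-1 : ℤ.+ p ∣ v ℤ.+ ℤ.+ 1) where

  open import Data.Nat as ℕ using (zero; suc; _<_; z≤n; s≤s)
  import Data.Nat.Properties as ℕ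
  import Data.Nat.Divisibility as ℕ
  open import Data.Nat.Induction using (<-rec)
  open import Data.Nat.Primality using (¬prime[0]; ¬prime[1])
  open import Data.Nat.Tactic.RingSolver using () renaming (solve-∀ to ℕsolve-∀)
  open import Data.Integer using (+_; _*_; _+_; _-_; -_)
  import Data.Integer.Properties as ℤ
  open import Data.Integer.Divisibility.Signed using (∣⇒∣ᵤ; ∣m⇒∣-m; ∣m⇒∣m*n)
  open import Data.Integer.Tactic.RingSolver using (solve-∀)
  open import Data.Product using (proj₁; proj₂; _,_)
  open import Relation.Nullary using (¬_)
  open import Relation.Binary.PropositionalEquality

  open Ternary
  open Residues p p-prime
  open Seq u v
  open Unfolding u v

  ∤2 : ¬ + p ∣ + 2
  ∤2 p∣2 with ℕ.∣⇒≤ (∣⇒∣ᵤ p∣2)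
  ... | z≤n             = ¬prime[0] p-prime
  ... | s≤s z≤n         = ¬prime[1] p-prime
  ... | s≤s (s≤s z≤n)   = p≢2 refl

  digitValue : ℕ → ℤ
  digitValue 2 = u
  digitValue _ = + 0

  digitValue-annihilates : ∀ d → digitValue d * (u - digitValue d) ≡ + 0
  digitValue-annihilates 0                 = refl
  digitValue-annihilates 1                 = refl
  digitValue-annihilates 2                 = u*[u-u]≡0 u
    where u*[u-u]≡0 : ∀ u → u * (u - u) ≡ + 0
          u*[u-u]≡0 = solve-∀
  digitValue-annihilates (suc (suc (suc _))) = refl

  α₂-residue : ℕ → ℤ
  α₂-residue k = digitValue (lastNonOneDigit k)

  α₂-residue-3j : ∀ j → α₂-residue (3 ℕ.* j) ≡ + 0
  α₂-residue-3j j = cong digitValue (lastNonOneDigit-3j j)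

  α₂-residue-3j+1 : ∀ j → α₂-residue (3 ℕ.* j ℕ.+ 1) ≡ α₂-residue j
  α₂-residue-3j+1 j = cong digitValue (lastNonOneDigit-3j+1 j)

  α₂-residue-3j+2 : ∀ j → α₂-residue (3 ℕ.* j ℕ.+ 2) ≡ u
  α₂-residue-3j+2 j = cong digitValue (lastNonOneDigit-3j+2 j)

  β₁-residue β₂-residue : ℕ → ℤ
  β₁-residue zero    = + 1
  β₁-residue (suc _) = - + 1
  β₂-residue zero    = - + 2
  β₂-residue (suc _) = - + 1

  record BlockResidues (k : ℕ) (e₁ e₂ e₃ : Entry) : Set where
    field
      α₁ : HasResidue (proj₁ e₁) (- u)
      α₂ : HasResidue (proj₁ e₂) (α₂-residue k)
      α₃ : HasResidue (proj₁ e₃) (u - α₂-residue k)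
      β₁ : HasResidue (proj₂ e₁) (β₁-residue k)
      β₂ : HasResidue (proj₂ e₂) (β₂-residue k)
      β₃ : HasResidue (proj₂ e₃) (- + 1)

  open BlockResidues public

  Block : ℕ → Set
  Block k = BlockResidues k (entry (3 ℕ.* k ℕ.+ 1)) (entry (3 ℕ.* k ℕ.+ 2)) (entry (3 ℕ.* k ℕ.+ 3))

  U-residue : HasResidue U u
  U-residue = int-residue u

  V-residue : HasResidue V (- + 1)
  V-residue = HasResidue-mod (int-residue v) v≡-1

  U²-residue : HasResidue (U ⊗ U) (- + 3)
  U²-residue = HasResidue-mod (U-residue ⊗ʳ U-residue) u²≡-3

  block₀ : Block 0
  block₀ = record
    { α₁ = int-residue (- u)
    ; α₂ = ⊘-residue (+ 0) (U-residue ⊗ʳ (int-residue (+ 2) ⊗ʳ V-residue ⊖ʳ int-residue (+ 1) ⊖ʳ U²-residue))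
                     den ∤2 (≡0⇒∣ (α₂-numerator u))
    ; α₃ = ⊘-residue (u - + 0) (int-residue (- u) ⊗ʳ (V-residue ⊖ʳ int-residue (+ 1))) den ∤2
                     (≡0⇒∣ (α₃-numerator u))
    ; β₁ = int-residue (+ 1)
    ; β₂ = U²-residue ⊖ʳ V-residue
    ; β₃ = ⊘-residue (- + 1) (U²-residue ⊕ʳ U⁴-residue ⊕ʳ V-residue ⊗ʳ V-residue ⊗ʳ V-residue ⊖ʳ 3U²V-residue)
                     (den ⊗ʳ den) (∤-* ∤2 ∤2) (≡0⇒∣ refl)
    }
    where
    den : HasResidue (V ⊖ U ⊗ U) (+ 2)
    den = V-residue ⊖ʳ U²-residue
    α₂-numerator : ∀ u → u * (+ 0) - + 0 * + 2 ≡ + 0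
    α₂-numerator = solve-∀
    α₃-numerator : ∀ u → - u * - + 2 - (u - + 0) * + 2 ≡ + 0
    α₃-numerator = solve-∀
    U⁴-residue : HasResidue (U ⊗ U ⊗ U ⊗ U) (+ 9)
    U⁴-residue = HasResidue-mod (U²-residue ⊗ʳ U-residue ⊗ʳ U-residue)
      (subst (+ p ∣_) (sym (U⁴ u)) (∣m⇒∣m*n (- + 3) u²≡-3))
      where U⁴ : ∀ u → - + 3 * u * u - + 9 ≡ (u * u + + 3) * - + 3
            U⁴ = solve-∀
    3U²V-residue : HasResidue (int (+ 3) ⊗ U ⊗ U ⊗ V) (+ 9)
    3U²V-residue = HasResidue-mod (int-residue (+ 3) ⊗ʳ U-residue ⊗ʳ U-residue ⊗ʳ V-residue)
      (subst (+ p ∣_) (sym (3U²V u)) (∣m⇒∣m*n (- + 3) u²≡-3))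
      where 3U²V : ∀ u → + 3 * u * u * - + 1 - + 9 ≡ (u * u + + 3) * - + 3
            3U²V = solve-∀

  β₂-residue-unit : ∀ k → ¬ + p ∣ β₂-residue k
  β₂-residue-unit zero    = ∤-neg ∤2
  β₂-residue-unit (suc _) = ∤-neg ∤1

  block-suc : ∀ k a → Block k → HasResidue (α (k ℕ.+ 2)) a → HasResidue (β (k ℕ.+ 2)) (β₂-residue k)
            → α₂-residue (suc k) ≡ a + α₂-residue k → Block (suc k)
  block-suc k a blk αₖ₊₂ βₖ₊₂ c′≡a+c =
    subst (λ (e₁ , e₂ , e₃) → BlockResidues (suc k) e₁ e₂ e₃) (sym (entries-next k)) record
      { α₁ = int-residue (- u)
      ; α₂ = α₅
      ; α₃ = U-residue ⊖ʳ α₅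
      ; β₁ = β₄
      ; β₂ = β₅
      ; β₃ = β₆
      }
    where
    c c′ : ℤ
    c  = α₂-residue k
    c′ = α₂-residue (suc k)
    B₄ B₅ A₅ : M
    B₄ = β (k ℕ.+ 2) ⊘ (β (3 ℕ.* k ℕ.+ 3) ⊗ β (3 ℕ.* k ℕ.+ 2))
    B₅ = U ⊗ U ⊖ V ⊖ B₄
    A₅ = U ⊖ (α (k ℕ.+ 2) ⊕ U ⊗ V ⊖ α (3 ℕ.* k ℕ.+ 2) ⊗ B₄) ⊘ B₅

    -- β (k+2) and β (3k+2) have the same residue, so B₄ ≡ b / (- b).
    β₄ : HasResidue B₄ (- + 1)
    β₄ = ⊘-residue (- + 1) βₖ₊₂ (β₃ blk ⊗ʳ β₂ blk) (∤-* (∤-neg ∤1) (β₂-residue-unit k))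
                   (≡0⇒∣ (β₄-numerator (β₂-residue k)))
      where β₄-numerator : ∀ b → b - - + 1 * (- + 1 * b) ≡ + 0
            β₄-numerator = solve-∀

    β₅ : HasResidue B₅ (- + 1)
    β₅ = U²-residue ⊖ʳ V-residue ⊖ʳ β₄

    α₅ : HasResidue A₅ c′
    α₅ = HasResidue-mod (U-residue ⊖ʳ quotient) (≡0⇒∣ (u-[u-c′]-c′ u c′))
      where
      u-[u-c′]-c′ : ∀ u c′ → u - (u - c′) - c′ ≡ + 0
      u-[u-c′]-c′ = solve-∀
      quotient-numerator : ∀ a u c → a + u * - + 1 - c * - + 1 - (u - (a + c)) * - + 1 ≡ + 0
      quotient-numerator = solve-∀
      quotient : HasResidue ((α (k ℕ.+ 2) ⊕ U ⊗ V ⊖ α (3 ℕ.* k ℕ.+ 2) ⊗ B₄) ⊘ B₅) (u - c′)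
      quotient = ⊘-residue (u - c′) (αₖ₊₂ ⊕ʳ U-residue ⊗ʳ V-residue ⊖ʳ α₂ blk ⊗ʳ β₄) β₅ (∤-neg ∤1)
        (≡0⇒∣ (trans (cong (λ z → a + u * - + 1 - c * - + 1 - (u - z) * - + 1) c′≡a+c) (quotient-numerator a u c)))

    β₆ : HasResidue (V ⊖ A₅ ⊗ (U ⊖ A₅)) (- + 1)
    β₆ = HasResidue-mod (V-residue ⊖ʳ α₅ ⊗ʳ (U-residue ⊖ʳ α₅))
           (subst (+ p ∣_) (sym (β₆-numerator u c′)) (∣m⇒∣-m (≡0⇒∣ (digitValue-annihilates (lastNonOneDigit (suc k))))))
      where β₆-numerator : ∀ u c′ → - + 1 - c′ * (u - c′) - - + 1 ≡ - (c′ * (u - c′))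
            β₆-numerator = solve-∀

  reindex : ∀ (f : ℕ → M) {i j r} → i ≡ j → HasResidue (f i) r → HasResidue (f j) r
  reindex f {r = r} i≡j = subst (λ i → HasResidue (f i) r) i≡j

  β₂-residue-3j : ∀ j → β₂-residue (3 ℕ.* j) ≡ β₂-residue j
  β₂-residue-3j zero    = refl
  β₂-residue-3j (suc _) = refl

  β₂-residue-+suc : ∀ m n → β₂-residue (m ℕ.+ suc n) ≡ - + 1
  β₂-residue-+suc m n rewrite ℕ.+-suc m n = refl

  next-block : ∀ k → (∀ {m} → m < suc k → Block m) → Block (suc k)
  next-block k earlier with ternary k
  ... | [3* j ] =
    block-suc k (α₂-residue j) (earlier ℕ.≤-refl) (α₂ (earlier j<k+1))
      (subst (HasResidue (β (3 ℕ.* j ℕ.+ 2))) (sym (β₂-residue-3j j)) (β₂ (earlier j<k+1)))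
      (begin
        α₂-residue (suc (3 ℕ.* j))          ≡⟨ cong α₂-residue (ℕ.+-comm 1 (3 ℕ.* j)) ⟩
        α₂-residue (3 ℕ.* j ℕ.+ 1)          ≡⟨ α₂-residue-3j+1 j ⟩
        α₂-residue j                        ≡⟨ ℤ.+-identityʳ _ ⟨
        α₂-residue j + + 0                  ≡⟨ cong (λ x → α₂-residue j + x) (α₂-residue-3j j) ⟨
        α₂-residue j + α₂-residue (3 ℕ.* j) ∎)
    where
    open ≡-Reasoning
    j<k+1 : j < suc (3 ℕ.* j)
    j<k+1 = s≤s (ℕ.m≤n*m j 3)
  ... | [3* j +1] =
    block-suc k (u - α₂-residue j) (earlier ℕ.≤-refl)
      (reindex α (sym (ℕ.+-assoc (3 ℕ.* j) 1 2)) (α₃ (earlier j<k+1)))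
      (reindex β (sym (ℕ.+-assoc (3 ℕ.* j) 1 2))
        (subst (HasResidue (β (3 ℕ.* j ℕ.+ 3))) (sym (β₂-residue-+suc (3 ℕ.* j) 0)) (β₃ (earlier j<k+1))))
      (begin
        α₂-residue (suc (3 ℕ.* j ℕ.+ 1))                  ≡⟨ cong α₂-residue (ℕ.+-suc (3 ℕ.* j) 1) ⟨
        α₂-residue (3 ℕ.* j ℕ.+ 2)                        ≡⟨ α₂-residue-3j+2 j ⟩
        u                                                 ≡⟨ u≡[u-c]+c u (α₂-residue j) ⟩
        u - α₂-residue j + α₂-residue j                   ≡⟨ cong (λ x → u - α₂-residue j + x) (α₂-residue-3j+1 j) ⟨
        u - α₂-residue j + α₂-residue (3 ℕ.* j ℕ.+ 1)     ∎)
    where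
    open ≡-Reasoning
    j<k+1 : j < suc (3 ℕ.* j ℕ.+ 1)
    j<k+1 = s≤s (ℕ.≤-trans (ℕ.m≤n*m j 3) (ℕ.m≤m+n (3 ℕ.* j) 1))
    u≡[u-c]+c : ∀ u c → u ≡ u - c + c
    u≡[u-c]+c = solve-∀
  ... | [3* j +2] =
    block-suc k (- u) (earlier ℕ.≤-refl)
      (reindex α (3[1+j]+1 j) (α₁ (earlier j+1<k+1)))
      (reindex β (3[1+j]+1 j)
        (subst (HasResidue (β (3 ℕ.* suc j ℕ.+ 1))) (sym (β₂-residue-+suc (3 ℕ.* j) 1)) (β₁ (earlier j+1<k+1))))
      (begin
        α₂-residue (suc (3 ℕ.* j ℕ.+ 2))    ≡⟨ cong α₂-residue (3[1+j]≡1+[3j+2] j) ⟨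
        α₂-residue (3 ℕ.* suc j)            ≡⟨ α₂-residue-3j (suc j) ⟩
        + 0                                 ≡⟨ -u+u≡0 u ⟨
        - u + u                             ≡⟨ cong (λ x → - u + x) (α₂-residue-3j+2 j) ⟨
        - u + α₂-residue (3 ℕ.* j ℕ.+ 2)    ∎)
    where
    open ≡-Reasoning
    j+1<k+1 : suc j < suc (3 ℕ.* j ℕ.+ 2)
    j+1<k+1 = s≤s (subst (ℕ._≤ 3 ℕ.* j ℕ.+ 2) (ℕ.+-comm j 1) (ℕ.+-mono-≤ (ℕ.m≤n*m j 3) (s≤s z≤n)))
    3[1+j]+1 : ∀ j → 3 ℕ.* suc j ℕ.+ 1 ≡ 3 ℕ.* j ℕ.+ 2 ℕ.+ 2
    3[1+j]+1 = ℕsolve-∀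
    -u+u≡0 : ∀ u → - u + u ≡ + 0
    -u+u≡0 = solve-∀

  blocks : ∀ k → Block k
  blocks = <-rec Block λ where
    zero    _       → block₀
    (suc k) earlier → next-block k earlier

  private
    3[1+j]+c : ∀ j c → 3 ℕ.* suc j ℕ.+ c ≡ 3 ℕ.* j ℕ.+ c ℕ.+ 3
    3[1+j]+c = ℕsolve-∀

  β-tail : ∀ k → HasResidue (β (k ℕ.+ 3)) (- + 1)
  β-tail k with ternary k
  ... | [3* j ]   = β₃ (blocks j)
  ... | [3* j +1] = reindex β (3[1+j]+c j 1) (β₁ (blocks (suc j)))
  ... | [3* j +2] = reindex β (3[1+j]+c j 2) (β₂ (blocks (suc j)))

open import Data.Nat using (ℕ; _+_; _*_)
open import Data.Nat.Primality using (Prime)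
open import Data.Integer as ℤ using (ℤ)
open import Data.Integer.Divisibility using () renaming (_∣_ to _∣ℤ_)
open import Data.Product using (_×_; _,_)
open import Relation.Binary.PropositionalEquality using (_≢_)

lemma2 : (p : ℕ) → Prime p → p ≢ 2 → (u v : ℤ)
       → ℤ.+ p ∣ℤ (u ℤ.* u ℤ.+ ℤ.+ 3) → ℤ.+ p ∣ℤ (v ℤ.+ ℤ.+ 1)
       → let open Seq u v in
         (β 1 ≡ int (ℤ.+ 1) [mod p ])
         × (β 2 ≡ int (ℤ.- ℤ.+ 2) [mod p ])
         × ((k : ℕ) →
             (α (3 * k + 1) ≡ int (ℤ.- u) [mod p ])
           × (α (3 * k + 2) ⊕ α (3 * k + 3) ≡ int u [mod p ])
           × (α (9 * k + 2) ≡ int (ℤ.+ 0) [mod p ])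
           × (α (9 * k + 5) ≡ α (3 * k + 2) [mod p ])
           × (α (9 * k + 8) ≡ int u [mod p ])
           × (β (k + 3) ≡ int (ℤ.- ℤ.+ 1) [mod p ]))
lemma2 p p-prime p≢2 u v u²≡-3 v≡-1 =
    residues⇒≡[mod] (β₁ (blocks 0)) (int-residue (ℤ.+ 1)) refl
  , residues⇒≡[mod] (β₂ (blocks 0)) (int-residue (ℤ.- ℤ.+ 2)) refl
  , λ k →
      residues⇒≡[mod] (α₁ (blocks k)) (int-residue (ℤ.- u)) refl
    , residues⇒≡[mod] (α₂ (blocks k) ⊕ʳ α₃ (blocks k)) (int-residue u) (c+[u-c]≡u (α₂-residue k) u)
    , residues⇒≡[mod] (reindex α (9k+2 k) (α₂ (blocks (3 * k)))) (int-residue (ℤ.+ 0)) (α₂-residue-3j k)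
    , residues⇒≡[mod] (reindex α (9k+5 k) (α₂ (blocks (3 * k + 1)))) (α₂ (blocks k)) (α₂-residue-3j+1 k)
    , residues⇒≡[mod] (reindex α (9k+8 k) (α₂ (blocks (3 * k + 2)))) (int-residue u) (α₂-residue-3j+2 k)
    , residues⇒≡[mod] (β-tail k) (int-residue (ℤ.- ℤ.+ 1)) refl
  where
  open Residues p p-prime
  open Seq u v
  open import Data.Integer.Divisibility.Signed using (∣ᵤ⇒∣)
  open Blocks p p-prime p≢2 u v (∣ᵤ⇒∣ u²≡-3) (∣ᵤ⇒∣ v≡-1)
  open import Relation.Binary.PropositionalEquality using (refl)
  open import Data.Integer.Tactic.RingSolver using (solve-∀)
  open import Data.Nat.Tactic.RingSolver using () renaming (solve-∀ to ℕsolve-∀)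
  c+[u-c]≡u : ∀ c u → c ℤ.+ (u ℤ.- c) ≡ u
  c+[u-c]≡u = solve-∀
  9k+2 : ∀ k → 3 * (3 * k) + 2 ≡ 9 * k + 2
  9k+2 = ℕsolve-∀
  9k+5 : ∀ k → 3 * (3 * k + 1) + 2 ≡ 9 * k + 5
  9k+5 = ℕsolve-∀
  9k+8 : ∀ k → 3 * (3 * k + 2) + 2 ≡ 9 * k + 8
  9k+8 = ℕsolve-∀
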